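{- For any tournament $T$, the relation $\sim$ on $V(T)$ is an equivalence relation.
   Context: In a tournament $T$, for vertices $u,v$ write $u \curvearrowright v$ if $u \to v$ and there exist $k \geq 0$ and vertices $w_1,\ldots,w_k$ such that, with $C(u,v) = \{u,w_1,\ldots,w_k,v\}$: (i) $u \to w_i \to v$ for all $1 \le i \le k$; (ii) $w_i \to w_j$ for all $1 \le i<j \le k$; (iii) for every $x \in V(T)\setminus C(u,v)$ and all $y,z \in C(u,v)$, $x \to y$ if and only if $x \to z$. Write $u \sim v$ if $u = v$, or $u \curvearrowright v$, or $v \curvearrowright u$. -}

module Defs where

open import Data.Nat using (ℕ)
open import Data.Fin using (Fin; _<_)
open import Data.Bool using (Bool; true; false; not)
open import Data.Product using (Σ; _×_; ∃; ∃-syntax)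
open import Data.Sum using (_⊎_)
open import Relation.Nullary using (¬_)
open import Relation.Binary.PropositionalEquality using (_≡_; _≢_)
open import Function.Bundles using (_⇔_)

record Tournament (n : ℕ) : Set where
  field
    arc        : Fin n → Fin n → Bool
    loopless   : ∀ u → arc u u ≡ false
    tournament : ∀ u v → u ≢ v → arc u v ≡ not (arc v u)

module _ {n : ℕ} (T : Tournament n) where
  open Tournament T

  _⟶_ : Fin n → Fin n → Set
  u ⟶ v = arc u v ≡ true

  InC : (u v : Fin n) {k : ℕ} (w : Fin k → Fin n) → Fin n → Set
  InC u v w y = y ≡ u ⊎ y ≡ v ⊎ ∃[ i ] y ≡ w i

  Witness : (u v : Fin n) {k : ℕ} (w : Fin k → Fin n) → Set
  Witness u v w =
      (∀ i → (u ⟶ w i) × (w i ⟶ v))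
    × (∀ i j → i < j → w i ⟶ w j)
    × (∀ x → ¬ InC u v w x → ∀ y z → InC u v w y → InC u v w z →
         (x ⟶ y) ⇔ (x ⟶ z))

  _↷_ : Fin n → Fin n → Set
  u ↷ v = (u ⟶ v) × Σ ℕ (λ k → Σ (Fin k → Fin n) (λ w → Witness u v w))

  _∼_ : Fin n → Fin n → Set
  u ∼ v = u ≡ v ⊎ u ↷ v ⊎ v ↷ u

-- List C(u,v) in its transitive order u, w₁, …, wₖ, v.  Then u ↷ v says that
-- this list is AllPairs-ordered by → and that C(u,v) is a module: every outside
-- vertex dominates all of it or is dominated by all of it.  If a ↷ b ↷ c, gluing
-- the two lists at b gives a ↷ c.  If a ↷ b and c ↷ b with a ≠ c, then either c
-- lies in C(a,b), and the part of C(a,b) up to c witnesses a ↷ c, or c → a by the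
-- module property; symmetrically a ↷ c or a → c, and c → a → c is impossible.
-- The case of a common source is the same argument in the reversed tournament.
module Submission where

open import Level using (_⊔_)
open import Data.Nat using (ℕ; s≤s)
open import Data.Fin as Fin using (Fin; zero; suc)
open import Data.Bool using (true; false)
open import Data.Bool.Properties using (not-¬)
open import Data.Product using (_×_; _,_; proj₁; proj₂; ∃-syntax)
open import Data.Sum as Sum using (_⊎_; inj₁; inj₂)
open import Data.Empty using (⊥-elim)
open import Data.List using (List; []; _∷_; _++_; [_]; filter; reverse; tabulate; lookup; length)
open import Data.List.Properties using (++-assoc; filter-accept; unfold-reverse; reverse-++; tabulate-lookup)
open import Data.List.Relation.Unary.All as All using (All; []; _∷_)
import Data.List.Relation.Unary.All.Properties as Allₚ
open import Data.List.Relation.Unary.Any using (here; there)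
import Data.List.Relation.Unary.Any.Properties as Anyₚ
open import Data.List.Relation.Unary.AllPairs using (AllPairs; []; _∷_)
import Data.List.Relation.Unary.AllPairs.Properties as AllPairsₚ
open import Data.List.Membership.Propositional using (_∈_; _∉_)
open import Data.List.Membership.Propositional.Properties
  using (∈-++⁺ˡ; ∈-++⁺ʳ; ∈-++⁻; ∈-filter⁺; ∈-filter⁻; ∈-tabulate⁺; ∈-tabulate⁻)
import Data.List.Membership.DecPropositional as DecMembership
open import Function using (flip; _∘_)
open import Function.Bundles using (mk⇔; Equivalence)
open import Relation.Binary.Core using (Rel)
open import Relation.Binary.Definitions using (Trichotomous; Decidable; tri<; tri≈; tri>)
open import Relation.Binary.Consequences using (tri⇒irr; tri⇒asym; tri⇒dec≈; tri⇒dec<)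
import Relation.Binary.Construct.Flip.EqAndOrd as Flip
open import Relation.Binary.PropositionalEquality
  using (_≡_; _≢_; refl; sym; trans; cong; subst; module ≡-Reasoning)
open import Relation.Binary.Structures using (IsEquivalence)
open import Relation.Nullary using (¬_; yes; no)
open import Relation.Unary using (Pred)

open import Defs

module _ {a ℓ} {V : Set a} (R : Rel V ℓ) where

  IsModule : List V → Set (a ⊔ ℓ)
  IsModule C = ∀ {x} → x ∉ C → All (R x) C ⊎ All (flip R x) C

  IsTransitiveModule : List V → Set (a ⊔ ℓ)
  IsTransitiveModule C = AllPairs R C × IsModule C

  Interval : V → V → Set (a ⊔ ℓ)
  Interval u v = ∃[ ws ] IsTransitiveModule (u ∷ ws ++ [ v ])

module _ {a ℓ} {V : Set a} {R : Rel V ℓ} where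

  All-reverse⁺ : ∀ {p} {P : Pred V p} {xs} → All P xs → All P (reverse xs)
  All-reverse⁺ ps = All.tabulate (All.lookup ps ∘ Anyₚ.reverse⁻)

  AllPairs-reverse⁺ : ∀ {xs} → AllPairs R xs → AllPairs (flip R) (reverse xs)
  AllPairs-reverse⁺ [] = []
  AllPairs-reverse⁺ {x ∷ xs} (x≺xs ∷ pairs) =
    subst (AllPairs (flip R)) (sym (unfold-reverse x xs))
      (AllPairsₚ.++⁺ (AllPairs-reverse⁺ pairs) ([] ∷ [])
        (All.tabulate λ y∈ → All.lookup x≺xs (Anyₚ.reverse⁻ y∈) ∷ []))

  AllPairs-++⁻ : ∀ xs {ys} → AllPairs R (xs ++ ys) →
                 AllPairs R xs × AllPairs R ys × All (λ x → All (R x) ys) xs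
  AllPairs-++⁻ []       pairs        = [] , pairs , []
  AllPairs-++⁻ (x ∷ xs) (x≺ ∷ pairs) with AllPairs-++⁻ xs pairs
  ... | xsPairs , ysPairs , cross =
    Allₚ.++⁻ˡ xs x≺ ∷ xsPairs , ysPairs , Allₚ.++⁻ʳ xs x≺ ∷ cross

  AllPairs-tabulate⁻ : ∀ {n} {f : Fin n → V} → AllPairs R (tabulate f) →
                       ∀ {i j} → i Fin.< j → R (f i) (f j)
  AllPairs-tabulate⁻ (f₀≺ ∷ _)   {zero}  {suc j} _         = Allₚ.tabulate⁻ f₀≺ j
  AllPairs-tabulate⁻ (_ ∷ pairs) {suc i} {suc j} (s≤s i<j) = AllPairs-tabulate⁻ pairs i<j

  IsModule-reverse : ∀ {C} → IsModule R C → IsModule (flip R) (reverse C)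
  IsModule-reverse mod x∉ = Sum.swap (Sum.map All-reverse⁺ All-reverse⁺ (mod (x∉ ∘ Anyₚ.reverse⁺)))

  Interval-flip : ∀ {u v} → Interval R u v → Interval (flip R) v u
  Interval-flip {u} {v} (ws , pairs , mod) =
    reverse ws , subst (IsTransitiveModule (flip R)) reverse-chain
                   (AllPairs-reverse⁺ pairs , IsModule-reverse mod)
    where
    open ≡-Reasoning
    reverse-chain : reverse (u ∷ ws ++ [ v ]) ≡ v ∷ reverse ws ++ [ u ]
    reverse-chain = begin
      reverse (u ∷ ws ++ [ v ])      ≡⟨ unfold-reverse u (ws ++ [ v ]) ⟩
      reverse (ws ++ [ v ]) ++ [ u ] ≡⟨ cong (_++ [ u ]) (reverse-++ ws [ v ]) ⟩
      v ∷ reverse ws ++ [ u ]        ∎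

module Intervals {a ℓ} {V : Set a} {_⇒_ : Rel V ℓ} (compare : Trichotomous _≡_ _⇒_) where

  irrefl : ∀ {x} → ¬ x ⇒ x
  irrefl = tri⇒irr compare refl

  asym : ∀ {x y} → x ⇒ y → ¬ y ⇒ x
  asym = tri⇒asym compare

  _⇒?_ : Decidable _⇒_
  _⇒?_ = tri⇒dec< compare

  open DecMembership (tri⇒dec≈ compare) using (_∈?_)

  ¬⇒-flip : ∀ {x y} → x ≢ y → ¬ x ⇒ y → y ⇒ x
  ¬⇒-flip {x} {y} x≢y x⇏y with compare x y
  ... | tri< x⇒y _ _ = ⊥-elim (x⇏y x⇒y)
  ... | tri≈ _ x≡y _ = ⊥-elim (x≢y x≡y)
  ... | tri> _ _ y⇒x = y⇒x

  ¬⇒head : ∀ {h t y} → AllPairs _⇒_ (h ∷ t) → y ∈ h ∷ t → ¬ y ⇒ h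
  ¬⇒head _          (here refl) = irrefl
  ¬⇒head (h⇒t ∷ _) (there y∈t) = asym (All.lookup h⇒t y∈t)

  AllPairs-trans : ∀ {xs x y z} → AllPairs _⇒_ xs → x ∈ xs → y ∈ xs → z ∈ xs →
                   x ⇒ y → y ⇒ z → x ⇒ z
  AllPairs-trans pairs x∈ (here refl) _ x⇒y _ = ⊥-elim (¬⇒head pairs x∈ x⇒y)
  AllPairs-trans pairs _ y∈ (here refl) _ y⇒z = ⊥-elim (¬⇒head pairs y∈ y⇒z)
  AllPairs-trans (x⇒t ∷ _) (here refl) (there _) (there z∈) _ _ = All.lookup x⇒t z∈
  AllPairs-trans (_ ∷ pairs) (there x∈) (there y∈) (there z∈) =
    AllPairs-trans pairs x∈ y∈ z∈

  IsModule-intro : ∀ {C} → (∀ {x y z} → x ∉ C → y ∈ C → z ∈ C → x ⇒ y → x ⇒ z) →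
                   IsModule _⇒_ C
  IsModule-intro {[]}    _     _ = inj₁ []
  IsModule-intro {c ∷ _} homog {x} x∉ with x ⇒? c
  ... | yes x⇒c = inj₁ (All.tabulate λ z∈ → homog x∉ (here refl) z∈ x⇒c)
  ... | no x⇏c  = inj₂ (All.tabulate λ z∈ →
    ¬⇒-flip (λ { refl → x∉ z∈ }) (λ x⇒z → x⇏c (homog x∉ z∈ (here refl) x⇒z)))

  IsModule-⇒ : ∀ {C x y} → IsModule _⇒_ C → x ∉ C → y ∈ C → x ⇒ y → All (x ⇒_) C
  IsModule-⇒ mod x∉ y∈ x⇒y with mod x∉
  ... | inj₁ x⇒C = x⇒C
  ... | inj₂ C⇒x = ⊥-elim (asym x⇒y (All.lookup C⇒x y∈))

  IsModule-⇐ : ∀ {C x y} → IsModule _⇒_ C → x ∉ C → y ∈ C → y ⇒ x → All (_⇒ x) C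
  IsModule-⇐ mod x∉ y∈ y⇒x with mod x∉
  ... | inj₁ x⇒C = ⊥-elim (asym y⇒x (All.lookup x⇒C y∈))
  ... | inj₂ C⇒x = C⇒x

  IsModule-elim : ∀ {C x y z} → IsModule _⇒_ C → x ∉ C → y ∈ C → z ∈ C → x ⇒ y → x ⇒ z
  IsModule-elim mod x∉ y∈ z∈ x⇒y = All.lookup (IsModule-⇒ mod x∉ y∈ x⇒y) z∈

  IsTransitiveModule-glue : ∀ P {b Q} → IsTransitiveModule _⇒_ (P ++ [ b ]) →
                            IsTransitiveModule _⇒_ (b ∷ Q) →
                            IsTransitiveModule _⇒_ (P ++ b ∷ Q)
  IsTransitiveModule-glue P {b} {Q} (pairs₁ , mod₁) (pairs₂ , mod₂) =
    AllPairsₚ.++⁺ pairsP pairs₂ (All.map dominates P⇒b) , mod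
    where
    pairsP = proj₁ (AllPairs-++⁻ P pairs₁)
    P⇒b = proj₂ (proj₂ (AllPairs-++⁻ P pairs₁))

    dominates : ∀ {x} → All (x ⇒_) [ b ] → All (x ⇒_) (b ∷ Q)
    dominates (x⇒b ∷ []) =
      IsModule-⇒ mod₂ (λ x∈ → ¬⇒head pairs₂ x∈ x⇒b) (here refl) x⇒b

    glue : ∀ {p} {Pr : Pred V p} → All Pr (P ++ [ b ]) → All Pr (b ∷ Q) → All Pr (P ++ b ∷ Q)
    glue pr₁ pr₂ = Allₚ.++⁺ (Allₚ.++⁻ˡ P pr₁) pr₂

    mod : IsModule _⇒_ (P ++ b ∷ Q)
    mod {x} x∉ with mod₁ x∉₁
      where
      x∉₁ : x ∉ P ++ [ b ]
      x∉₁ x∈ with ∈-++⁻ P x∈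
      ... | inj₁ x∈P        = x∉ (∈-++⁺ˡ x∈P)
      ... | inj₂ (here x≡b) = x∉ (∈-++⁺ʳ P (here x≡b))
    ... | inj₁ x⇒C₁ = inj₁ (glue x⇒C₁ (IsModule-⇒ mod₂ (x∉ ∘ ∈-++⁺ʳ P) (here refl)
                                         (All.head (Allₚ.++⁻ʳ P x⇒C₁))))
    ... | inj₂ C₁⇒x = inj₂ (glue C₁⇒x (IsModule-⇐ mod₂ (x∉ ∘ ∈-++⁺ʳ P) (here refl)
                                         (All.head (Allₚ.++⁻ʳ P C₁⇒x))))

  IsTransitiveModule-prefix : ∀ {C c} → IsTransitiveModule _⇒_ C → c ∈ C →
                              IsTransitiveModule _⇒_ (filter (_⇒? c) C ++ [ c ])
  IsTransitiveModule-prefix {C} {c} (pairs , mod) c∈C = pairs′ , mod′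
    where
    F = filter (_⇒? c) C

    ∈F⁻ : ∀ {y} → y ∈ F → y ∈ C × y ⇒ c
    ∈F⁻ = ∈-filter⁻ (_⇒? c)

    pairs′ : AllPairs _⇒_ (F ++ [ c ])
    pairs′ = AllPairsₚ.++⁺ (AllPairsₚ.filter⁺ (_⇒? c) pairs) ([] ∷ [])
               (All.tabulate λ y∈ → proj₂ (∈F⁻ y∈) ∷ [])

    ⊆C : ∀ {y} → y ∈ F ++ [ c ] → y ∈ C
    ⊆C y∈ with ∈-++⁻ F y∈
    ... | inj₁ y∈F         = proj₁ (∈F⁻ y∈F)
    ... | inj₂ (here refl) = c∈C

    mod′ : IsModule _⇒_ (F ++ [ c ])
    mod′ {x} x∉ with x ∈? C
    ... | no x∉C  = Sum.map (Allₚ.anti-mono ⊆C) (Allₚ.anti-mono ⊆C) (mod x∉C)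
    ... | yes x∈C = inj₂ (All.tabulate below)
      where
      c⇒x : c ⇒ x
      c⇒x = ¬⇒-flip (λ { refl → x∉ (∈-++⁺ʳ F (here refl)) })
                    (λ x⇒c → x∉ (∈-++⁺ˡ (∈-filter⁺ (_⇒? c) x∈C x⇒c)))

      below : ∀ {y} → y ∈ F ++ [ c ] → y ⇒ x
      below y∈ with ∈-++⁻ F y∈
      ... | inj₁ y∈F         = AllPairs-trans pairs (proj₁ (∈F⁻ y∈F)) c∈C x∈C (proj₂ (∈F⁻ y∈F)) c⇒x
      ... | inj₂ (here refl) = c⇒x

  _↝_ : Rel V (a ⊔ ℓ)
  _↝_ = Interval _⇒_

  ↝⇒⇒ : ∀ {u v} → u ↝ v → u ⇒ v
  ↝⇒⇒ (ws , u⇒ ∷ _ , _) = All.lookup u⇒ (∈-++⁺ʳ ws (here refl))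

  ↝-trans : ∀ {u v w} → u ↝ v → v ↝ w → u ↝ w
  ↝-trans {u} {v} {w} (ws₁ , tm₁) (ws₂ , tm₂) =
    ws₁ ++ v ∷ ws₂ ,
    subst (λ ws → IsTransitiveModule _⇒_ (u ∷ ws)) (sym (++-assoc ws₁ (v ∷ ws₂) [ w ]))
      (IsTransitiveModule-glue (u ∷ ws₁) tm₁ tm₂)

  ↝-prefix : ∀ {u v c ws} → IsTransitiveModule _⇒_ (u ∷ ws ++ [ v ]) →
             c ∈ u ∷ ws ++ [ v ] → u ⇒ c → u ↝ c
  ↝-prefix {u} {v} {c} {ws} tm c∈ u⇒c =
    filter (_⇒? c) (ws ++ [ v ]) ,
    subst (λ C → IsTransitiveModule _⇒_ (C ++ [ c ])) (filter-accept (_⇒? c) u⇒c)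
      (IsTransitiveModule-prefix tm c∈)

  ↝-prefix-or-⇐ : ∀ {u v c} → u ↝ v → c ⇒ v → u ≢ c → u ↝ c ⊎ c ⇒ u
  ↝-prefix-or-⇐ {u} {v} {c} (ws , tm@(u⇒ ∷ _ , mod)) c⇒v u≢c with c ∈? u ∷ ws ++ [ v ]
  ... | yes (here c≡u)     = ⊥-elim (u≢c (sym c≡u))
  ... | yes c∈@(there c∈′) = inj₁ (↝-prefix tm c∈ (All.lookup u⇒ c∈′))
  ... | no c∉              =
    inj₂ (IsModule-elim mod c∉ (there (∈-++⁺ʳ ws (here refl))) (here refl) c⇒v)

  ↝-sameTarget : ∀ {u v w} → u ↝ v → w ↝ v → u ≢ w → u ↝ w ⊎ w ↝ u
  ↝-sameTarget u↝v w↝v u≢w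
    with ↝-prefix-or-⇐ u↝v (↝⇒⇒ w↝v) u≢w | ↝-prefix-or-⇐ w↝v (↝⇒⇒ u↝v) (u≢w ∘ sym)
  ... | inj₁ u↝w | _        = inj₁ u↝w
  ... | _        | inj₁ w↝u = inj₂ w↝u
  ... | inj₂ w⇒u | inj₂ u⇒w = ⊥-elim (asym u⇒w w⇒u)

module Similarity {a ℓ} {V : Set a} {_⇒_ : Rel V ℓ} (compare : Trichotomous _≡_ _⇒_) where

  open Intervals compare public
  private module Op = Intervals (Flip.compare _⇒_ compare)

  ↝-sameSource : ∀ {u v w} → v ↝ u → v ↝ w → u ≢ w → u ↝ w ⊎ w ↝ u
  ↝-sameSource v↝u v↝w u≢w =
    Sum.swap (Sum.map Interval-flip Interval-flip
      (Op.↝-sameTarget (Interval-flip v↝u) (Interval-flip v↝w) u≢w))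

  _≃_ : Rel V (a ⊔ ℓ)
  u ≃ v = u ≡ v ⊎ u ↝ v ⊎ v ↝ u

  ≃-from-≢ : ∀ {u v} → (u ≢ v → u ↝ v ⊎ v ↝ u) → u ≃ v
  ≃-from-≢ {u} {v} f with tri⇒dec≈ compare u v
  ... | yes u≡v = inj₁ u≡v
  ... | no u≢v  = inj₂ (f u≢v)

  ≃-trans : ∀ {u v w} → u ≃ v → v ≃ w → u ≃ w
  ≃-trans (inj₁ refl)       q                 = q
  ≃-trans p                 (inj₁ refl)       = p
  ≃-trans (inj₂ (inj₁ u↝v)) (inj₂ (inj₁ v↝w)) = inj₂ (inj₁ (↝-trans u↝v v↝w))
  ≃-trans (inj₂ (inj₂ v↝u)) (inj₂ (inj₂ w↝v)) = inj₂ (inj₂ (↝-trans w↝v v↝u))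
  ≃-trans (inj₂ (inj₁ u↝v)) (inj₂ (inj₂ w↝v)) = ≃-from-≢ (↝-sameTarget u↝v w↝v)
  ≃-trans (inj₂ (inj₂ v↝u)) (inj₂ (inj₁ v↝w)) = ≃-from-≢ (↝-sameSource v↝u v↝w)

module _ {n : ℕ} (T : Tournament n) where
  open Tournament T

  ⟶-compare : Trichotomous _≡_ (_⟶_ T)
  ⟶-compare u v with u Fin.≟ v
  ... | yes refl = tri≈ loop refl loop
    where
    loop : ¬ arc u u ≡ true
    loop u⟶u = not-¬ refl (trans (sym (loopless u)) u⟶u)
  ... | no u≢v with arc u v | tournament u v u≢v | tournament v u (u≢v ∘ sym)
  ... | true  | u⟶v≡¬v⟶u | _         = tri< refl u≢v λ v⟶u → not-¬ (sym v⟶u) u⟶v≡¬v⟶u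
  ... | false | _         | v⟶u≡¬u⟶v = tri> (λ ()) u≢v v⟶u≡¬u⟶v

  open Similarity ⟶-compare

  ∈-chain⇒InC : ∀ {u v k} {w : Fin k → Fin n} {y} →
                y ∈ u ∷ tabulate w ++ [ v ] → InC T u v w y
  ∈-chain⇒InC         (here y≡u) = inj₁ y≡u
  ∈-chain⇒InC {w = w} (there y∈) with ∈-++⁻ (tabulate w) y∈
  ... | inj₁ y∈w        = inj₂ (inj₂ (∈-tabulate⁻ y∈w))
  ... | inj₂ (here y≡v) = inj₂ (inj₁ y≡v)

  InC⇒∈-chain : ∀ {u v k} {w : Fin k → Fin n} {y} →
                InC T u v w y → y ∈ u ∷ tabulate w ++ [ v ]
  InC⇒∈-chain         (inj₁ refl)              = here refl
  InC⇒∈-chain {w = w} (inj₂ (inj₁ refl))       = there (∈-++⁺ʳ (tabulate w) (here refl))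
  InC⇒∈-chain         (inj₂ (inj₂ (i , refl))) = there (∈-++⁺ˡ (∈-tabulate⁺ i))

  Witness⇒IsTransitiveModule : ∀ {u v k} {w : Fin k → Fin n} → _⟶_ T u v → Witness T u v w →
                               IsTransitiveModule (_⟶_ T) (u ∷ tabulate w ++ [ v ])
  Witness⇒IsTransitiveModule u⟶v (ends , increasing , homogeneous) =
    Allₚ.++⁺ (Allₚ.tabulate⁺ (proj₁ ∘ ends)) (u⟶v ∷ [])
      ∷ AllPairsₚ.++⁺ (AllPairsₚ.tabulate⁺-< (increasing _ _)) ([] ∷ [])
          (Allₚ.tabulate⁺ λ i → proj₂ (ends i) ∷ []) ,
    IsModule-intro λ {x} x∉ y∈ z∈ →
      Equivalence.to (homogeneous x (x∉ ∘ InC⇒∈-chain) _ _ (∈-chain⇒InC y∈) (∈-chain⇒InC z∈))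

  IsTransitiveModule⇒Witness : ∀ {u v k} {w : Fin k → Fin n} →
                               IsTransitiveModule (_⟶_ T) (u ∷ tabulate w ++ [ v ]) → Witness T u v w
  IsTransitiveModule⇒Witness {u} {v} {w = w} (u⟶ ∷ pairs , mod) =
    (λ i → All.lookup u⟶ (∈-++⁺ˡ (∈-tabulate⁺ i)) , All.head (Allₚ.tabulate⁻ w⟶v i)) ,
    (λ i j → AllPairs-tabulate⁻ wPairs) ,
    λ x x∉ y z y∈ z∈ → mk⇔ (elim x∉ y∈ z∈) (elim x∉ z∈ y∈)
    where
    wPairs = proj₁ (AllPairs-++⁻ (tabulate w) pairs)
    w⟶v = proj₂ (proj₂ (AllPairs-++⁻ (tabulate w) pairs))
    elim : ∀ {x y z} → ¬ InC T u v w x → InC T u v w y → InC T u v w z → _⟶_ T x y → _⟶_ T x z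
    elim x∉ y∈ z∈ = IsModule-elim mod (x∉ ∘ ∈-chain⇒InC) (InC⇒∈-chain y∈) (InC⇒∈-chain z∈)

  ↷⇒↝ : ∀ {u v} → _↷_ T u v → u ↝ v
  ↷⇒↝ (u⟶v , _ , w , witness) = tabulate w , Witness⇒IsTransitiveModule u⟶v witness

  ↝⇒↷ : ∀ {u v} → u ↝ v → _↷_ T u v
  ↝⇒↷ {u} {v} u↝v@(ws , tm) =
    ↝⇒⇒ u↝v , length ws , lookup ws ,
    IsTransitiveModule⇒Witness
      (subst (λ ws → IsTransitiveModule (_⟶_ T) (u ∷ ws ++ [ v ])) (sym (tabulate-lookup ws)) tm)

lemma3 : ∀ {n : ℕ} (T : Tournament n) → IsEquivalence (_∼_ T)
lemma3 T = record
  { refl  = inj₁ refl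
  ; sym   = Sum.map sym Sum.swap
  ; trans = λ p q → toDefs (≃-trans (fromDefs p) (fromDefs q))
  }
  where
  open Similarity (⟶-compare T)
  fromDefs : ∀ {u v} → _∼_ T u v → u ≃ v
  fromDefs = Sum.map₂ (Sum.map (↷⇒↝ T) (↷⇒↝ T))
  toDefs : ∀ {u v} → u ≃ v → _∼_ T u v
  toDefs = Sum.map₂ (Sum.map (↝⇒↷ T) (↝⇒↷ T))
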